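{- Let $\mathcal R$ be a polarized rewrite system and fix a pre-model of $\mathcal R$. Then for all propositions $A$, $B$: if $A \longrightarrow_{ - } B$ then $|A| \subseteq |B|$, and if $A \longrightarrow_{+} B$ then $|B| \subseteq |A|$.
   Context: Propositions are built from atomic propositions (propositional symbols) and the constant $\bot$ using the binary connectives $\Rightarrow$, $\wedge$, $\vee$. A rewrite rule is a pair $P \longrightarrow A$ with $P$ an atomic proposition and $A$ an arbitrary proposition. A polarized rewrite system $\mathcal R = \langle \mathcal R_{ - }, \mathcal R_{+}\rangle$ is a pair of sets of rewrite rules; rules of $\mathcal R_{ - }$ are called negative, those of $\mathcal R_{+}$ positive. The one-step relations $\longrightarrow^1_{ - }$, $\longrightarrow^1_{+}$ are the least relations on propositions such that: $P \longrightarrow^1_{ - } A$ for every negative rule $P \longrightarrow A$; $P \longrightarrow^1_{+} A$ for every positive rule $P\longrightarrow A$; $A \Rightarrow B \longrightarrow^1_{ - } A' \Rightarrow B$ if $A \longrightarrow^1_{+} A'$, and $A \Rightarrow B \longrightarrow^1_{ - } A \Rightarrow B'$ if $B \longrightarrow^1_{ - } B'$; $A \Rightarrow B \longrightarrow^1_{+} A' \Rightarrow B$ if $A \longrightarrow^1_{ - } A'$, and $A \Rightarrow B \longrightarrow^1_{+} A \Rightarrow B'$ if $B \longrightarrow^1_{+} B'$; for $\circ \in \{\wedge, \vee\}$ and $s \in \{ -,+\}$, $A \circ B \longrightarrow^1_{s} A' \circ B$ if $A \longrightarrow^1_{s} A'$, and $A \circ B \longrightarrow^1_{s} A \circ B'$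 if $B \longrightarrow^1_{s} B'$. The relations $\longrightarrow_{ - }$, $\longrightarrow_{+}$ are the reflexive-transitive closures of $\longrightarrow^1_{ - }$, $\longrightarrow^1_{+}$. Proof-terms: $\pi ::= \alpha \mid \lambda\alpha\,\pi \mid (\pi_1\,\pi_2) \mid \langle \pi_1,\pi_2\rangle \mid \mathit{fst}(\pi) \mid \mathit{snd}(\pi) \mid i(\pi) \mid j(\pi) \mid \delta(\pi_1, \alpha\pi_2, \beta\pi_3) \mid \delta_\bot(\pi)$, with $\alpha,\beta$ proof variables ($\lambda\alpha$ binds $\alpha$; in $\delta(\pi_1,\alpha\pi_2,\beta\pi_3)$, $\alpha$ is bound in $\pi_2$ and $\beta$ in $\pi_3$). Proof reduction: $\triangleright^1$ is the closure under all term contexts of the rules $(\lambda\alpha\,\pi_1\;\pi_2) \triangleright [\pi_2/\alpha]\pi_1$, $\mathit{fst}(\langle\pi_1,\pi_2\rangle) \triangleright \pi_1$, $\mathit{snd}(\langle\pi_1,\pi_2\rangle)\triangleright \pi_2$, $\delta(i(\pi_1),\alpha\pi_2,\beta\pi_3)\triangleright[\pi_1/\alpha]\pi_2$, $\delta(j(\pi_1),\alpha\pi_2,\beta\pi_3)\triangleright[\pi_1/\beta]\pi_3$ (capture-avoiding substitution); $\triangleright$ is its reflexive-transitive closure; "$\pi$ reduces to $\pi'$" means $\pi\triangleright\pi'$. A proof-term is strongly normalizable if there is no infinite $\triangleright^1$-sequence starting from it. A proof-term is neutral if it is a variable or of the form $(\pi_1\,\pi_2)$, $\mathit{fst}(\pi)$,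 $\mathit{snd}(\pi)$, $\delta(\pi_1,\alpha\pi_2,\beta\pi_3)$ or $\delta_\bot(\pi)$. A set $R$ of proof-terms is a reducibility candidate if: every element of $R$ is strongly normalizable; if $\pi \in R$ and $\pi \triangleright \pi'$ then $\pi' \in R$; if $\pi$ is neutral and every $\pi'$ with $\pi \triangleright^1 \pi'$ is in $R$, then $\pi \in R$. A pre-model is a function assigning a reducibility candidate $\hat P$ to each atomic proposition $P$. Given a pre-model, $|A|$ is defined by induction on $A$: $|P| = \hat P$ for $P$ atomic; $\pi \in |A \Rightarrow B|$ iff $\pi$ is strongly normalizable and whenever $\pi$ reduces to $\lambda\alpha\,\pi_1$, $[\pi'/\alpha]\pi_1 \in |B|$ for every $\pi' \in |A|$; $\pi \in |A \wedge B|$ iff $\pi$ is strongly normalizable and whenever $\pi$ reduces to $\langle\pi_1,\pi_2\rangle$, $\pi_1 \in |A|$ and $\pi_2 \in |B|$; $\pi \in |A\vee B|$ iff $\pi$ is strongly normalizable and whenever $\pi$ reduces to $i(\pi_1)$ (resp. $j(\pi_2)$), $\pi_1 \in |A|$ (resp. $\pi_2 \in |B|$); $\pi \in |\bot|$ iff $\pi$ is strongly normalizable. A pre-model is a pre-model of $\mathcal R$ if $|P| \subseteq |A|$ for every negative rule $P \longrightarrow A$ and $|A| \subseteq |P|$ for every positive rule $P \longrightarrow A$. -}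

module Defs where

open import Data.Nat using (ℕ; zero; suc; _<_; _≟_)
open import Data.Nat.Base using (_<ᵇ_)
open import Data.Bool using (if_then_else_)
open import Data.Product using (_×_; Σ; _,_)
open import Relation.Binary.PropositionalEquality using (_≡_)
open import Relation.Nullary using (yes; no)
open import Level using (Level; _⊔_) renaming (suc to lsuc; zero to lzero)

data Prop (Atom : Set) : Set where
  atom : Atom → Prop Atom
  ⊥′   : Prop Atom
  _⇒_  : Prop Atom → Prop Atom → Prop Atom
  _∧_  : Prop Atom → Prop Atom → Prop Atom
  _∨_  : Prop Atom → Prop Atom → Prop Atom

RuleSet : Set → (ℓ : Level) → Set (lsuc ℓ)
RuleSet Atom ℓ = Atom → Prop Atom → Set ℓ

record PolarizedRS (Atom : Set) (ℓ : Level) : Set (lsuc ℓ) where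
  field
    neg : RuleSet Atom ℓ
    pos : RuleSet Atom ℓ

data Sign : Set where
  - + : Sign

flip : Sign → Sign
flip - = +
flip + = -

module _ {Atom : Set} {ℓ : Level} (R : PolarizedRS Atom ℓ) where
  open PolarizedRS R

  data Step : Sign → Prop Atom → Prop Atom → Set ℓ where
    rule- : ∀ {P A} → neg P A → Step - (atom P) A
    rule+ : ∀ {P A} → pos P A → Step + (atom P) A
    ⇒l : ∀ {s A A′ B} → Step (flip s) A A′ → Step s (A ⇒ B) (A′ ⇒ B)
    ⇒r : ∀ {s A B B′} → Step s B B′ → Step s (A ⇒ B) (A ⇒ B′)
    ∧l : ∀ {s A A′ B} → Step s A A′ → Step s (A ∧ B) (A′ ∧ B)
    ∧r : ∀ {s A B B′} → Step s B B′ → Step s (A ∧ B) (A ∧ B′)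
    ∨l : ∀ {s A A′ B} → Step s A A′ → Step s (A ∨ B) (A′ ∨ B)
    ∨r : ∀ {s A B B′} → Step s B B′ → Step s (A ∨ B) (A ∨ B′)

  data Steps (s : Sign) : Prop Atom → Prop Atom → Set ℓ where
    done : ∀ {A} → Steps s A A
    more : ∀ {A B C} → Step s A B → Steps s B C → Steps s A C

-- Proof-terms, with proof variables as de Bruijn indices
-- (lam binds one variable; δ binds one variable in each branch).

data Term : Set where
  var  : ℕ → Term
  lam  : Term → Term
  app  : Term → Term → Term
  pair : Term → Term → Term
  fst  : Term → Term
  snd  : Term → Term
  inl  : Term → Term
  inr  : Term → Term
  δ    : Term → Term → Term → Term
  δ⊥   : Term → Term

shift : ℕ → Term → Term
shift c (var n) = if n <ᵇ c then var n else var (suc n)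
shift c (lam t) = lam (shift (suc c) t)
shift c (app t u) = app (shift c t) (shift c u)
shift c (pair t u) = pair (shift c t) (shift c u)
shift c (fst t) = fst (shift c t)
shift c (snd t) = snd (shift c t)
shift c (inl t) = inl (shift c t)
shift c (inr t) = inr (shift c t)
shift c (δ t u v) = δ (shift c t) (shift (suc c) u) (shift (suc c) v)
shift c (δ⊥ t) = δ⊥ (shift c t)

-- subst k u t : replace variable k by u in t, decrementing variables above k
subst : ℕ → Term → Term → Term
subst k u (var n) with n ≟ k
... | yes _ = u
... | no _ = if n <ᵇ k then var n else var (Data.Nat.pred n)
subst k u (lam t) = lam (subst (suc k) (shift 0 u) t)
subst k u (app t t′) = app (subst k u t) (subst k u t′)
subst k u (pair t t′) = pair (subst k u t) (subst k u t′)
subst k u (fst t) = fst (subst k u t)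
subst k u (snd t) = snd (subst k u t)
subst k u (inl t) = inl (subst k u t)
subst k u (inr t) = inr (subst k u t)
subst k u (δ t t′ t″) = δ (subst k u t) (subst (suc k) (shift 0 u) t′) (subst (suc k) (shift 0 u) t″)
subst k u (δ⊥ t) = δ⊥ (subst k u t)

-- [u/α]t where α is the outermost bound variable (index 0)
_[_] : Term → Term → Term
t [ u ] = subst 0 u t

data _▷¹_ : Term → Term → Set where
  β-lam : ∀ {t u} → app (lam t) u ▷¹ (t [ u ])
  β-fst : ∀ {t u} → fst (pair t u) ▷¹ t
  β-snd : ∀ {t u} → snd (pair t u) ▷¹ u
  β-inl : ∀ {t u v} → δ (inl t) u v ▷¹ (u [ t ])
  β-inr : ∀ {t u v} → δ (inr t) u v ▷¹ (v [ t ])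
  c-lam   : ∀ {t t′} → t ▷¹ t′ → lam t ▷¹ lam t′
  c-app₁  : ∀ {t t′ u} → t ▷¹ t′ → app t u ▷¹ app t′ u
  c-app₂  : ∀ {t u u′} → u ▷¹ u′ → app t u ▷¹ app t u′
  c-pair₁ : ∀ {t t′ u} → t ▷¹ t′ → pair t u ▷¹ pair t′ u
  c-pair₂ : ∀ {t u u′} → u ▷¹ u′ → pair t u ▷¹ pair t u′
  c-fst   : ∀ {t t′} → t ▷¹ t′ → fst t ▷¹ fst t′
  c-snd   : ∀ {t t′} → t ▷¹ t′ → snd t ▷¹ snd t′
  c-inl   : ∀ {t t′} → t ▷¹ t′ → inl t ▷¹ inl t′
  c-inr   : ∀ {t t′} → t ▷¹ t′ → inr t ▷¹ inr t′
  c-δ₁    : ∀ {t t′ u v} → t ▷¹ t′ → δ t u v ▷¹ δ t′ u v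
  c-δ₂    : ∀ {t u u′ v} → u ▷¹ u′ → δ t u v ▷¹ δ t u′ v
  c-δ₃    : ∀ {t u v v′} → v ▷¹ v′ → δ t u v ▷¹ δ t u v′
  c-δ⊥    : ∀ {t t′} → t ▷¹ t′ → δ⊥ t ▷¹ δ⊥ t′

data _▷_ : Term → Term → Set where
  ▷-refl : ∀ {t} → t ▷ t
  ▷-step : ∀ {t u v} → t ▷¹ u → u ▷ v → t ▷ v

-- Strong normalizability: no infinite ▷¹-sequence (inductive accessibility)
data SN (t : Term) : Set where
  sn : (∀ {t′} → t ▷¹ t′ → SN t′) → SN t

data Neutral : Term → Set where
  n-var : ∀ {n} → Neutral (var n)
  n-app : ∀ {t u} → Neutral (app t u)
  n-fst : ∀ {t} → Neutral (fst t)
  n-snd : ∀ {t} → Neutral (snd t)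
  n-δ   : ∀ {t u v} → Neutral (δ t u v)
  n-δ⊥  : ∀ {t} → Neutral (δ⊥ t)

TermSet : Set₁
TermSet = Term → Set

_⊆_ : TermSet → TermSet → Set
X ⊆ Y = ∀ {t} → X t → Y t

record IsCandidate (X : TermSet) : Set where
  field
    cr-sn      : ∀ {t} → X t → SN t
    cr-red     : ∀ {t t′} → X t → t ▷ t′ → X t′
    cr-neutral : ∀ {t} → Neutral t → (∀ {t′} → t ▷¹ t′ → X t′) → X t

record Candidate : Set₁ where
  field
    set  : TermSet
    isCR : IsCandidate set

PreModel : Set → Set₁
PreModel Atom = Atom → Candidate

⟦_⟧ : {Atom : Set} → Prop Atom → PreModel Atom → TermSet
⟦ atom P ⟧ M t = Candidate.set (M P) t
⟦ ⊥′ ⟧ M t = SN t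
⟦ A ⇒ B ⟧ M t = SN t × (∀ {t₁} → t ▷ lam t₁ → ∀ {u} → ⟦ A ⟧ M u → ⟦ B ⟧ M (t₁ [ u ]))
⟦ A ∧ B ⟧ M t = SN t × (∀ {t₁ t₂} → t ▷ pair t₁ t₂ → ⟦ A ⟧ M t₁ × ⟦ B ⟧ M t₂)
⟦ A ∨ B ⟧ M t = SN t × (∀ {t₁} → t ▷ inl t₁ → ⟦ A ⟧ M t₁)
                     × (∀ {t₂} → t ▷ inr t₂ → ⟦ B ⟧ M t₂)

record IsPreModelOf {Atom : Set} {ℓ : Level} (R : PolarizedRS Atom ℓ) (M : PreModel Atom) : Set (lsuc lzero ⊔ ℓ) where
  open PolarizedRS R
  field
    negSound : ∀ {P A} → neg P A → ⟦ atom P ⟧ M ⊆ ⟦ A ⟧ M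
    posSound : ∀ {P A} → pos P A → ⟦ A ⟧ M ⊆ ⟦ atom P ⟧ M

-- The interpretation of each connective is monotone in its
-- arguments, except that ⇒ is antitone in its premise; this is exactly the
-- polarity discipline of the one-step relations, so a negative (positive)
-- step shrinks (enlarges) the interpretation.
module Submission where

open import Defs
open import Data.Product using (_×_; _,_; map₂)
open import Function using (id; _∘_)
open import Level using (Level)

-- Chosen so that ⟦ A ⇒ B ⟧ M is definitionally ⟦ A ⟧ M ⇒ˢ ⟦ B ⟧ M, and likewise for ∧, ∨.
_⇒ˢ_ : TermSet → TermSet → TermSet
(X ⇒ˢ Y) t = SN t × (∀ {t₁} → t ▷ lam t₁ → ∀ {u} → X u → Y (t₁ [ u ]))

_∧ˢ_ : TermSet → TermSet → TermSet
(X ∧ˢ Y) t = SN t × (∀ {t₁ t₂} → t ▷ pair t₁ t₂ → X t₁ × Y t₂)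

_∨ˢ_ : TermSet → TermSet → TermSet
(X ∨ˢ Y) t = SN t × (∀ {t₁} → t ▷ inl t₁ → X t₁) × (∀ {t₂} → t ▷ inr t₂ → Y t₂)

⇒ˢ-mono : ∀ {X X′ Y Y′} → X′ ⊆ X → Y ⊆ Y′ → (X ⇒ˢ Y) ⊆ (X′ ⇒ˢ Y′)
⇒ˢ-mono X′⊆X Y⊆Y′ = map₂ λ f red x′ → Y⊆Y′ (f red (X′⊆X x′))

∧ˢ-mono : ∀ {X X′ Y Y′} → X ⊆ X′ → Y ⊆ Y′ → (X ∧ˢ Y) ⊆ (X′ ∧ˢ Y′)
∧ˢ-mono X⊆X′ Y⊆Y′ = map₂ λ f red → let x , y = f red in X⊆X′ x , Y⊆Y′ y

∨ˢ-mono : ∀ {X X′ Y Y′} → X ⊆ X′ → Y ⊆ Y′ → (X ∨ˢ Y) ⊆ (X′ ∨ˢ Y′)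
∨ˢ-mono X⊆X′ Y⊆Y′ (h , f , g) = h , X⊆X′ ∘ f , Y⊆Y′ ∘ g

Oriented : Sign → TermSet → TermSet → Set
Oriented - X Y = X ⊆ Y
Oriented + X Y = Y ⊆ X

Monotone : (TermSet → TermSet) → Set₁
Monotone F = ∀ {X Y} → X ⊆ Y → F X ⊆ F Y

Antitone : (TermSet → TermSet) → Set₁
Antitone F = ∀ {X Y} → X ⊆ Y → F Y ⊆ F X

oriented-refl : ∀ s {X} → Oriented s X X
oriented-refl - = id
oriented-refl + = id

oriented-trans : ∀ s {X Y Z} → Oriented s X Y → Oriented s Y Z → Oriented s X Z
oriented-trans - X⊆Y Y⊆Z = Y⊆Z ∘ X⊆Y
oriented-trans + Y⊆X Z⊆Y = Y⊆X ∘ Z⊆Y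

monotone-oriented : ∀ {F} → Monotone F → ∀ s {X Y} → Oriented s X Y → Oriented s (F X) (F Y)
monotone-oriented F-mono - = F-mono
monotone-oriented F-mono + = F-mono

antitone-oriented : ∀ {F} → Antitone F → ∀ s {X Y} → Oriented (flip s) X Y → Oriented s (F X) (F Y)
antitone-oriented F-anti - = F-anti
antitone-oriented F-anti + = F-anti

module _ {Atom : Set} {ℓ : Level} {R : PolarizedRS Atom ℓ} {M : PreModel Atom}
         (pre-model : IsPreModelOf R M) where
  open IsPreModelOf pre-model

  step-oriented : ∀ {s A B} → Step R s A B → Oriented s (⟦ A ⟧ M) (⟦ B ⟧ M)
  step-oriented (rule- r) = negSound r
  step-oriented (rule+ r) = posSound r
  step-oriented {s} (⇒l {B = B} st) =
    antitone-oriented {λ X → X ⇒ˢ ⟦ B ⟧ M} (λ X⊆Y → ⇒ˢ-mono {Y = ⟦ B ⟧ M} X⊆Y id) s (step-oriented st)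
  step-oriented {s} (⇒r {A = A} st) =
    monotone-oriented {λ Y → ⟦ A ⟧ M ⇒ˢ Y} (⇒ˢ-mono {X = ⟦ A ⟧ M} id) s (step-oriented st)
  step-oriented {s} (∧l {B = B} st) =
    monotone-oriented {λ X → X ∧ˢ ⟦ B ⟧ M} (λ X⊆Y → ∧ˢ-mono {Y = ⟦ B ⟧ M} X⊆Y id) s (step-oriented st)
  step-oriented {s} (∧r {A = A} st) =
    monotone-oriented {λ Y → ⟦ A ⟧ M ∧ˢ Y} (∧ˢ-mono {X = ⟦ A ⟧ M} id) s (step-oriented st)
  step-oriented {s} (∨l {B = B} st) =
    monotone-oriented {λ X → X ∨ˢ ⟦ B ⟧ M} (λ X⊆Y → ∨ˢ-mono {Y = ⟦ B ⟧ M} X⊆Y id) s (step-oriented st)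
  step-oriented {s} (∨r {A = A} st) =
    monotone-oriented {λ Y → ⟦ A ⟧ M ∨ˢ Y} (∨ˢ-mono {X = ⟦ A ⟧ M} id) s (step-oriented st)

  steps-oriented : ∀ {s A B} → Steps R s A B → Oriented s (⟦ A ⟧ M) (⟦ B ⟧ M)
  steps-oriented {s} done = oriented-refl s
  steps-oriented {s} (more st sts) = oriented-trans s (step-oriented st) (steps-oriented sts)

proposition5 : {Atom : Set} {ℓ : Level} (R : PolarizedRS Atom ℓ) (M : PreModel Atom) →
    IsPreModelOf R M →
    (∀ {A B} → Steps R - A B → ⟦ A ⟧ M ⊆ ⟦ B ⟧ M) ×
    (∀ {A B} → Steps R + A B → ⟦ B ⟧ M ⊆ ⟦ A ⟧ M)
proposition5 R M pre-model = steps-oriented pre-model , steps-oriented pre-model
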